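{- Let $n \geq 3$ be an integer and let $D_{2n} = \langle a, b \mid a^n = b^2 = e,\ ab = ba^{ -1}\rangle$ be the dihedral group of order $2n$. Then the power graph $\mathcal{P}(D_{2n})$ is cyclically separable if and only if all of the following hold: (i) $n$ has at least two distinct prime factors; (ii) $n \neq p_1p_2$ for any primes $p_1<p_2$ with $p_1 \leq 3$; (iii) $n \neq 12$.
   Context: The power graph $\mathcal{P}(G)$ of a group $G$ is the simple undirected graph with vertex set $G$ in which two distinct vertices are adjacent if one of them is a positive power of the other. For a graph $\Gamma$, a set $S$ of vertices is a cyclic vertex cutset if $\Gamma - S$ is disconnected and has at least two components each of which contains a cycle; $\Gamma$ is cyclically separable if it has a cyclic vertex cutset. -}

module Defs where

open import Level using (Level)
open import Data.Nat using (ℕ; zero; suc; _+_; _∸_; _≤_; _<_)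
open import Data.Nat.DivMod using (_%_; m%n<n)
open import Data.Fin using (Fin; toℕ; fromℕ<)
open import Data.List using (List; []; _∷_; _++_; length; take)
open import Data.List.Relation.Unary.All using (All)
open import Data.List.Relation.Unary.Linked using (Linked)
open import Data.List.Relation.Unary.Unique.Propositional using (Unique)
open import Data.Product using (Σ; ∃; _×_; _,_)
open import Data.Sum using (_⊎_)
open import Relation.Binary.PropositionalEquality using (_≡_; _≢_)
open import Relation.Nullary using (¬_)

_+ₙ_ : ∀ {n} → Fin n → Fin n → Fin n
_+ₙ_ {suc m} i j = fromℕ< (m%n<n (toℕ i + toℕ j) (suc m))

-ₙ_ : ∀ {n} → Fin n → Fin n
-ₙ_ {suc m} i = fromℕ< (m%n<n (suc m ∸ toℕ i) (suc m))

_-ₙ_ : ∀ {n} → Fin n → Fin n → Fin n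
i -ₙ j = i +ₙ (-ₙ j)

-- The dihedral group D_{2n} = ⟨ a, b | aⁿ = b² = e, ab = ba⁻¹ ⟩
-- rot i  represents  a^i,   ref i  represents  a^i b   (i mod n)

data Dih (n : ℕ) : Set where
  rot : Fin n → Dih n
  ref : Fin n → Dih n

-- multiplication, using  b a^j = a^{-j} b
_·_ : ∀ {n} → Dih n → Dih n → Dih n
rot i · rot j = rot (i +ₙ j)
rot i · ref j = ref (i +ₙ j)
ref i · rot j = ref (i -ₙ j)
ref i · ref j = rot (i -ₙ j)

-- posPow _∙_ x k = x^(k+1)   (positive powers)
posPow : ∀ {a} {A : Set a} → (A → A → A) → A → ℕ → A
posPow _∙_ x zero    = x
posPow _∙_ x (suc k) = posPow _∙_ x k ∙ x

PowerAdj : ∀ {a} {A : Set a} → (A → A → A) → A → A → Set a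
PowerAdj _∙_ x y =
  x ≢ y × ((∃ λ k → y ≡ posPow _∙_ x k) ⊎ (∃ λ k → x ≡ posPow _∙_ y k))

module _ {a} {V : Set a} (Adj : V → V → Set a) where

  data Reach (S : V → Set a) (u : V) : V → Set a where
    here : ¬ S u → Reach S u u
    step : ∀ {v w} → Reach S u v → Adj v w → ¬ S w → Reach S u w

  IsCycle : List V → Set a
  IsCycle vs = 3 ≤ length vs × Unique vs × Linked Adj (vs ++ take 1 vs)

  ComponentHasCycle : (S : V → Set a) → V → Set a
  ComponentHasCycle S u = Σ (List V) λ vs → IsCycle vs × All (Reach S u) vs

  IsCyclicVertexCutset : (V → Set a) → Set a
  IsCyclicVertexCutset S =
    Σ V λ u → Σ V λ v →
      ¬ S u × ¬ S v × ¬ Reach S u v ×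
      ComponentHasCycle S u × ComponentHasCycle S v

  CyclicallySeparable : Set (Level.suc a)
  CyclicallySeparable = Σ (V → Set a) IsCyclicVertexCutset

module Submission where

-- In the power graph of D₂ₙ a reflection is adjacent only to e, and two rotations aⁱ, aʲ are
-- adjacent iff ⟨aⁱ⟩ and ⟨aʲ⟩ are nested, i.e. iff gcd(i, n) and gcd(j, n) are comparable under
-- divisibility.  If n is a prime power, a product p₁p₂ with p₁ ≤ 3, or 12, some set of pairwise
-- adjacent rotations containing e meets every path on three vertices; every cycle then reaches
-- this set, so no two cycles can be separated.  Otherwise n has divisors s and t, neither dividing
-- the other, such that ⟨aˢ⟩ ∖ ⟨aᵗ⟩ and ⟨aᵗ⟩ ∖ ⟨aˢ⟩ both contain a triangle aˢ, a⁻ˢ, a^(cs).  No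
-- edge joins these two sets, so deleting all other vertices separates the two triangles.

open import Defs
open import Data.Nat
  using (ℕ; zero; suc; _+_; _*_; _∸_; _^_; _≤_; _<_; z≤n; s≤s; _≟_;
         NonZero; ≢-nonZero; ≢-nonZero⁻¹; nonTrivial⇒n>1)
open import Data.Nat.Properties
open import Data.Nat.DivMod
open import Data.Nat.Divisibility
open import Data.Nat.GCD using (gcd; gcd[m,n]∣m; gcd[m,n]∣n; gcd-greatest; gcd-identityˡ; gcd-GCD; module Bézout)
open import Data.Nat.Coprimality using (Coprime; coprime-divisor)
open import Data.Nat.Primality
  using (Prime; euclidsLemma; prime⇒irreducible; prime⇒nonZero; prime⇒nonTrivial; ¬prime[1]; prime[2])
open import Data.Nat.Primality.Factorisation using (factorise)
open import Data.Nat.ListAction using (product)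
open import Data.Nat.Solver using (module +-*-Solver)
open import Data.Fin using (Fin; toℕ)
import Data.Fin as Fin
open import Data.Fin.Properties using (toℕ-fromℕ<; toℕ-injective; toℕ<n; all?)
open import Data.List using ([]; _∷_; length)
open import Data.List.Relation.Unary.All using (All; []; _∷_; head)
open import Data.List.Relation.Unary.AllPairs using ([]; _∷_)
open import Data.List.Relation.Unary.Linked using ([-]; _∷_)
open import Data.Product using (Σ; ∃; _×_; _,_; proj₁)
open import Data.Sum using (_⊎_; inj₁; inj₂)
open import Data.Empty using (⊥; ⊥-elim)
open import Data.Unit using (⊤; tt)
open import Function using (_∘_; flip)
open import Function.Bundles using (_⇔_; mk⇔)
open import Relation.Binary.Definitions using (tri<; tri≈; tri>)
open import Relation.Binary.PropositionalEquality
open import Relation.Nullary using (¬_; Dec; yes; no; ¬?)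
open import Relation.Nullary.Decidable using (toWitness; toWitnessFalse; _⊎-dec_; _→-dec_)

open Bézout.Identity using (+-; -+)
open +-*-Solver using (solve; _:+_; _:*_; _:=_; con)

[m%d+n]%d≡[m+n]%d : ∀ m n d .{{_ : NonZero d}} → (m % d + n) % d ≡ (m + n) % d
[m%d+n]%d≡[m+n]%d m n d = begin
  (m % d + n) % d           ≡⟨ %-distribˡ-+ (m % d) n d ⟩
  (m % d % d + n % d) % d   ≡⟨ cong (λ r → (r + n % d) % d) (m%n%n≡m%n m d) ⟩
  (m % d + n % d) % d       ≡⟨ %-distribˡ-+ m n d ⟨
  (m + n) % d               ∎
  where open ≡-Reasoning

[m*[n%d]]%d≡[m*n]%d : ∀ m n d .{{_ : NonZero d}} → (m * (n % d)) % d ≡ (m * n) % d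
[m*[n%d]]%d≡[m*n]%d m n d = begin
  (m * (n % d)) % d           ≡⟨ %-distribˡ-* m (n % d) d ⟩
  (m % d * (n % d % d)) % d   ≡⟨ cong (λ r → (m % d * r) % d) (m%n%n≡m%n n d) ⟩
  (m % d * (n % d)) % d       ≡⟨ %-distribˡ-* m n d ⟨
  (m * n) % d                 ∎
  where open ≡-Reasoning

∣m∣n⇒∣m∸n : ∀ {d m n} → d ∣ m → d ∣ n → n ≤ m → d ∣ m ∸ n
∣m∣n⇒∣m∸n {d} d∣m d∣n n≤m = ∣m+n∣m⇒∣n (subst (d ∣_) (sym (m+[n∸m]≡n n≤m)) d∣m) d∣n

nonzero-multiple<3q : ∀ {q x} → q ∣ x → x ≢ 0 → x < 3 * q → x ≡ q ⊎ x ≡ 2 * q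
nonzero-multiple<3q (divides zero refl) x≢0 _ = ⊥-elim (x≢0 refl)
nonzero-multiple<3q {q} (divides 1 refl) _ _ = inj₁ (+-identityʳ q)
nonzero-multiple<3q (divides 2 refl) _ _ = inj₂ refl
nonzero-multiple<3q {q} (divides (suc (suc (suc k))) refl) _ x<3q =
  ⊥-elim (<⇒≱ x<3q (*-monoˡ-≤ q (m≤m+n 3 k)))

no-three-distinct-in-pair : ∀ {a b x y z : ℕ} → x ≢ y → x ≢ z → y ≢ z →
                            x ≡ a ⊎ x ≡ b → y ≡ a ⊎ y ≡ b → z ≡ a ⊎ z ≡ b → ⊥
no-three-distinct-in-pair x≢y _ _ (inj₁ refl) (inj₁ refl) _ = x≢y refl
no-three-distinct-in-pair x≢y _ _ (inj₂ refl) (inj₂ refl) _ = x≢y refl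
no-three-distinct-in-pair _ x≢z _ (inj₁ refl) _ (inj₁ refl) = x≢z refl
no-three-distinct-in-pair _ x≢z _ (inj₂ refl) _ (inj₂ refl) = x≢z refl
no-three-distinct-in-pair _ _ y≢z _ (inj₁ refl) (inj₁ refl) = y≢z refl
no-three-distinct-in-pair _ _ y≢z _ (inj₂ refl) (inj₂ refl) = y≢z refl

prime>1 : ∀ {p} → Prime p → 1 < p
prime>1 {p} p-prime = nonTrivial⇒n>1 p {{prime⇒nonTrivial p-prime}}

∤⇒coprime : ∀ {p d} → Prime p → ¬ p ∣ d → Coprime d p
∤⇒coprime p-prime p∤d {e} (e∣d , e∣p) with prime⇒irreducible p-prime e∣p
... | inj₁ e≡1 = e≡1
... | inj₂ refl = ⊥-elim (p∤d e∣d)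

prime∤* : ∀ {p a b} → Prime p → ¬ p ∣ a → ¬ p ∣ b → ¬ p ∣ a * b
prime∤* {a = a} {b} p-prime p∤a p∤b p∣ab with euclidsLemma a b p-prime p∣ab
... | inj₁ p∣a = p∤a p∣a
... | inj₂ p∣b = p∤b p∣b

prime∤prime : ∀ {p q} → Prime p → Prime q → p ≢ q → ¬ p ∣ q
prime∤prime p-prime q-prime p≢q p∣q with prime⇒irreducible q-prime p∣q
... | inj₁ refl = ¬prime[1] p-prime
... | inj₂ p≡q  = p≢q p≡q

^-monoʳ-∣ : ∀ p {i j} → i ≤ j → p ^ i ∣ p ^ j
^-monoʳ-∣ p {i} {j} i≤j = divides (p ^ (j ∸ i))
  (trans (cong (p ^_) (sym (m∸n+n≡m i≤j))) (^-distribˡ-+-* p (j ∸ i) i))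

∣p^k⇒≡p^i : ∀ {p} → Prime p → ∀ k {d} → d ∣ p ^ k → ∃ λ i → d ≡ p ^ i
∣p^k⇒≡p^i p-prime zero d∣1 = 0 , ∣1⇒≡1 d∣1
∣p^k⇒≡p^i {p} p-prime (suc k) {d} d∣p^k+1 with p ∣? d
... | no p∤d = ∣p^k⇒≡p^i p-prime k (coprime-divisor (∤⇒coprime p-prime p∤d) d∣p^k+1)
... | yes (divides d′ refl) with ∣p^k⇒≡p^i p-prime k {d′} d′∣p^k
  where
  instance _ = prime⇒nonZero p-prime
  d′∣p^k = *-cancelʳ-∣ p (subst (d′ * p ∣_) (*-comm p (p ^ k)) d∣p^k+1)
... | i , refl = suc i , *-comm (p ^ i) p

divisors-of-prime-power-comparable : ∀ {p k d e} → Prime p → d ∣ p ^ k → e ∣ p ^ k → d ∣ e ⊎ e ∣ d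
divisors-of-prime-power-comparable {p} {k} p-prime d∣p^k e∣p^k
  with ∣p^k⇒≡p^i p-prime k d∣p^k | ∣p^k⇒≡p^i p-prime k e∣p^k
... | i , refl | j , refl with ≤-total i j
... | inj₁ i≤j = inj₁ (^-monoʳ-∣ p i≤j)
... | inj₂ j≤i = inj₂ (^-monoʳ-∣ p j≤i)

product-of-copies : ∀ {p xs} → All (_≡ p) xs → product xs ≡ p ^ length xs
product-of-copies           []           = refl
product-of-copies {p} (refl ∷ ≡ps) = cong (p *_) (product-of-copies ≡ps)

copies-or-other-prime : ∀ p {xs} → All Prime xs →
                        All (_≡ p) xs ⊎ ∃ λ q → Prime q × q ≢ p × q ∣ product xs
copies-or-other-prime p [] = inj₁ []
copies-or-other-prime p {x ∷ xs} (x-prime ∷ primes) with x ≟ p | copies-or-other-prime p primes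
... | no x≢p  | _                                = inj₂ (x , x-prime , x≢p , m∣m*n (product xs))
... | yes x≡p | inj₁ ≡ps                         = inj₁ (x≡p ∷ ≡ps)
... | yes _   | inj₂ (q , q-prime , q≢p , q∣xs) = inj₂ (q , q-prime , q≢p , ∣n⇒∣m*n x q∣xs)

TwoPrimeDivisors : ℕ → Set
TwoPrimeDivisors n = Σ ℕ λ p → Σ ℕ λ q → Prime p × Prime q × p ≢ q × p ∣ n × q ∣ n

SmallPrimeProduct : ℕ → Set
SmallPrimeProduct n = Σ ℕ λ p₁ → Σ ℕ λ p₂ → Prime p₁ × Prime p₂ × p₁ < p₂ × p₁ ≤ 3 × n ≡ p₁ * p₂

prime-power-or-two-prime-divisors : ∀ n → 2 ≤ n →
                                    (∃ λ p → ∃ λ k → Prime p × n ≡ p ^ k) ⊎ TwoPrimeDivisors n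
prime-power-or-two-prime-divisors n@(suc _) 2≤n with factorise n
... | record { factors = [] ; isFactorisation = n≡1 } = ⊥-elim (<-irrefl (sym n≡1) 2≤n)
... | record { factors = p ∷ ps ; isFactorisation = n≡pps ; factorsPrime = p-prime ∷ primes }
  with copies-or-other-prime p primes
... | inj₁ ≡ps = inj₁ (p , suc (length ps) , p-prime , trans n≡pps (cong (p *_) (product-of-copies ≡ps)))
... | inj₂ (q , q-prime , q≢p , q∣ps) =
  inj₂ (p , q , p-prime , q-prime , q≢p ∘ sym , subst (p ∣_) (sym n≡pps) (m∣m*n (product ps)) ,
        subst (q ∣_) (sym n≡pps) (∣n⇒∣m*n p q∣ps))

cofactor : ∀ {p q n} → Prime p → Prime q → p ≢ q → p ∣ n → q ∣ n → ∃ λ k → n ≡ k * q * p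
cofactor {p} {q} p-prime q-prime p≢q (divides a n≡ap) q∣n
  with euclidsLemma a p q-prime (subst (q ∣_) n≡ap q∣n)
... | inj₁ (divides k a≡kq) = k , trans n≡ap (cong (_* p) a≡kq)
... | inj₂ q∣p              = ⊥-elim (prime∤prime q-prime p-prime (p≢q ∘ sym) q∣p)

module PowerGraph {a} {A : Set a} (_∙_ : A → A → A) where

  private
    Adj : A → A → Set a
    Adj = PowerAdj _∙_

  adj-sym : ∀ {x y} → Adj x y → Adj y x
  adj-sym (x≢y , inj₁ y=xᵏ) = x≢y ∘ sym , inj₂ y=xᵏ
  adj-sym (x≢y , inj₂ x=yᵏ) = x≢y ∘ sym , inj₁ x=yᵏ

  module _ {S : A → Set a} where

    reach-∉ : ∀ {u v} → Reach Adj S u v → ¬ S v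
    reach-∉ (here u∉S)     = u∉S
    reach-∉ (step _ _ v∉S) = v∉S

    reach-trans : ∀ {u v w} → Reach Adj S u v → Reach Adj S v w → Reach Adj S u w
    reach-trans u~v (here _)          = u~v
    reach-trans u~v (step v~w w-x x∉S) = step (reach-trans u~v v~w) w-x x∉S

    reach-sym : ∀ {u v} → Reach Adj S u v → Reach Adj S v u
    reach-sym (here u∉S)          = here u∉S
    reach-sym (step u~v v-w w∉S) =
      reach-trans (step (here w∉S) (adj-sym v-w) (reach-∉ u~v)) (reach-sym u~v)

  record Triangle (P : A → Set a) : Set a where
    constructor triangle
    field
      {x y z} : A
      xy     : Adj x y
      yz     : Adj y z
      zx     : Adj z x
      inside : All P (x ∷ y ∷ z ∷ [])

  triangle⇒cycle : ∀ {P S : A → Set a} → (∀ {v} → P v → ¬ S v) →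
                   (T : Triangle P) → ComponentHasCycle Adj S (Triangle.x T)
  triangle⇒cycle P⇒∉S (triangle {x} {y} {z} xy yz zx (Px ∷ Py ∷ Pz ∷ [])) =
      x ∷ y ∷ z ∷ []
    , (s≤s (s≤s (s≤s z≤n)) , distinct , (xy ∷ yz ∷ zx ∷ [-]))
    , here x∉S ∷ step (here x∉S) xy (P⇒∉S Py) ∷ step (here x∉S) (adj-sym zx) (P⇒∉S Pz) ∷ []
    where
    x∉S = P⇒∉S Px
    distinct = (proj₁ xy ∷ proj₁ zx ∘ sym ∷ []) ∷ (proj₁ yz ∷ []) ∷ [] ∷ []

  separable-by-triangles : (P Q : A → Set a) → (∀ {x} → P x → ¬ Q x) →
                           (∀ {x y} → P x → Adj x y → ¬ Q y) →
                           Triangle P → Triangle Q → CyclicallySeparable Adj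
  separable-by-triangles P Q P∩Q=∅ no-edge TP TQ =
      Outside , Triangle.x TP , Triangle.x TQ
    , P⇒¬Outside Px , Q⇒¬Outside Qy
    , (λ x~y → stays-in-P Px x~y (λ Py → P∩Q=∅ Py Qy))
    , triangle⇒cycle P⇒¬Outside TP , triangle⇒cycle Q⇒¬Outside TQ
    where
    Outside : A → Set a
    Outside v = ¬ P v × ¬ Q v

    P⇒¬Outside : ∀ {v} → P v → ¬ Outside v
    P⇒¬Outside Pv (¬Pv , _) = ¬Pv Pv

    Q⇒¬Outside : ∀ {v} → Q v → ¬ Outside v
    Q⇒¬Outside Qv (_ , ¬Qv) = ¬Qv Qv

    Px = head (Triangle.inside TP)
    Qy = head (Triangle.inside TQ)

    -- double negation, since membership in P need not be decidable
    stays-in-P : ∀ {u v} → P u → Reach Adj Outside u v → ¬ ¬ P v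
    stays-in-P Pu (here _)            ¬Pu = ¬Pu Pu
    stays-in-P Pu (step u~v v-w w∉) ¬Pw =
      stays-in-P Pu u~v (λ Pv → w∉ (¬Pw , no-edge Pv v-w))

  module _ (H : A → Set a)
           (paths-meet-hubs : ∀ {x y z} → x ≢ z → Adj x y → Adj y z → H x ⊎ H y ⊎ H z) where

    hub-in-component : ∀ {S w} → ComponentHasCycle Adj S w → ∃ λ h → H h × Reach Adj S w h
    hub-in-component (x ∷ y ∷ z ∷ _ , (_ , ((_ ∷ x≢z ∷ _) ∷ _) , (xy ∷ yz ∷ _)) , (w~x ∷ w~y ∷ w~z ∷ _))
      with paths-meet-hubs x≢z xy yz
    ... | inj₁ Hx        = x , Hx , w~x
    ... | inj₂ (inj₁ Hy) = y , Hy , w~y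
    ... | inj₂ (inj₂ Hz) = z , Hz , w~z
    hub-in-component ([] , (() , _) , _)
    hub-in-component (_ ∷ [] , (s≤s () , _) , _)
    hub-in-component (_ ∷ _ ∷ [] , (s≤s (s≤s ()) , _) , _)

    not-separable-by-hubs : (∀ {x y} → H x → H y → x ≡ y ⊎ Adj x y) → ¬ CyclicallySeparable Adj
    not-separable-by-hubs hubs-linked (S , u , v , _ , _ , u≁v , cu , cv)
      with hub-in-component cu | hub-in-component cv
    ... | h , Hh , u~h | h′ , Hh′ , v~h′ =
      u≁v (reach-trans (reach-trans u~h h~h′) (reach-sym v~h′))
      where
      h~h′ : Reach Adj S h h′
      h~h′ with hubs-linked Hh Hh′
      ... | inj₁ refl = here (reach-∉ u~h)
      ... | inj₂ h-h′ = step (here (reach-∉ u~h)) h-h′ (reach-∉ v~h′)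

module Dihedral (m : ℕ) where

  N : ℕ
  N = suc m

  Adj : Dih N → Dih N → Set
  Adj = PowerAdj (_·_ {N})

  open PowerGraph (_·_ {N}) public

  e : Dih N
  e = rot Fin.zero

  toℕ-mod : ∀ v → toℕ (v mod N) ≡ v % N
  toℕ-mod v = toℕ-fromℕ< _

  mod-cong : ∀ u v → u % N ≡ v % N → u mod N ≡ v mod N
  mod-cong u v eq = toℕ-injective (trans (toℕ-mod u) (trans eq (sym (toℕ-mod v))))

  toℕ-mod-inverse : ∀ (i : Fin N) → toℕ i mod N ≡ i
  toℕ-mod-inverse i = toℕ-injective (trans (toℕ-mod (toℕ i)) (m<n⇒m%n≡m (toℕ<n i)))

  toℕ-mod-< : ∀ {v} → v < N → toℕ (v mod N) ≡ v
  toℕ-mod-< {v} v<N = trans (toℕ-mod v) (m<n⇒m%n≡m v<N)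

  rot-injective : ∀ {i j : Fin N} → rot i ≡ rot j → i ≡ j
  rot-injective refl = refl

  rot≢ref : ∀ {i j : Fin N} → rot i ≢ ref j
  rot≢ref ()

  rot-pow : ∀ i k → posPow _·_ (rot i) k ≡ rot ((suc k * toℕ i) mod N)
  rot-pow i zero =
    cong rot (sym (trans (mod-cong (toℕ i + 0) (toℕ i) (%-congˡ (+-identityʳ (toℕ i)))) (toℕ-mod-inverse i)))
  rot-pow i (suc k) = begin
    posPow _·_ (rot i) k · rot i               ≡⟨ cong (_· rot i) (rot-pow i k) ⟩
    rot ((toℕ (u mod N) + toℕ i) mod N)       ≡⟨ cong rot (mod-cong (toℕ (u mod N) + toℕ i) (toℕ i + u) step-mod) ⟩
    rot ((suc (suc k) * toℕ i) mod N)          ∎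
    where
    open ≡-Reasoning
    u = suc k * toℕ i
    step-mod : (toℕ (u mod N) + toℕ i) % N ≡ (toℕ i + u) % N
    step-mod = begin
      (toℕ (u mod N) + toℕ i) % N   ≡⟨ cong (λ r → (r + toℕ i) % N) (toℕ-mod u) ⟩
      (u % N + toℕ i) % N           ≡⟨ [m%d+n]%d≡[m+n]%d u (toℕ i) N ⟩
      (u + toℕ i) % N               ≡⟨ %-congˡ (+-comm u (toℕ i)) ⟩
      (toℕ i + u) % N               ∎

  ref-square : ∀ i → ref i · ref i ≡ e
  ref-square i = cong rot (mod-cong (toℕ i + toℕ ((N ∸ toℕ i) mod N)) 0 (begin
    (toℕ i + toℕ ((N ∸ toℕ i) mod N)) % N   ≡⟨ cong (λ r → (toℕ i + r) % N) (toℕ-mod (N ∸ toℕ i)) ⟩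
    (toℕ i + (N ∸ toℕ i) % N) % N           ≡⟨ %-congˡ (+-comm (toℕ i) _) ⟩
    ((N ∸ toℕ i) % N + toℕ i) % N           ≡⟨ [m%d+n]%d≡[m+n]%d (N ∸ toℕ i) (toℕ i) N ⟩
    ((N ∸ toℕ i) + toℕ i) % N               ≡⟨ %-congˡ (m∸n+n≡m (<⇒≤ (toℕ<n i))) ⟩
    N % N                                   ≡⟨ n%n≡0 N ⟩
    0                                       ∎))
    where open ≡-Reasoning

  e·ref : ∀ i → e · ref i ≡ ref i
  e·ref i = cong ref (toℕ-mod-inverse i)

  ref-pow : ∀ i k → posPow _·_ (ref i) k ≡ ref i ⊎ posPow _·_ (ref i) k ≡ e
  ref-pow i zero = inj₁ refl
  ref-pow i (suc k) with ref-pow i k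
  ... | inj₁ eq = inj₂ (trans (cong (_· ref i) eq) (ref-square i))
  ... | inj₂ eq = inj₁ (trans (cong (_· ref i) eq) (e·ref i))

  ref-adj⇒e : ∀ {i v} → Adj (ref i) v → v ≡ e
  ref-adj⇒e {i} (i≢v , inj₁ (k , v=iᵏ)) with ref-pow i k
  ... | inj₁ eq = ⊥-elim (i≢v (sym (trans v=iᵏ eq)))
  ... | inj₂ eq = trans v=iᵏ eq
  ref-adj⇒e {i} {rot j} (_ , inj₂ (k , i=vᵏ)) = ⊥-elim (rot≢ref (sym (trans i=vᵏ (rot-pow j k))))
  ref-adj⇒e {i} {ref j} (i≢v , inj₂ (k , i=vᵏ)) with ref-pow j k
  ... | inj₁ eq = ⊥-elim (i≢v (trans i=vᵏ eq))
  ... | inj₂ eq = ⊥-elim (rot≢ref (sym (trans i=vᵏ eq)))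

  -- ⟨aⁱ⟩ = ⟨a^gcd(i,N)⟩, so ⟨aⁱ⟩ and ⟨aʲ⟩ are nested iff these gcds are comparable
  rotGcd : Fin N → ℕ
  rotGcd i = gcd (toℕ i) N

  Nested : Fin N → Fin N → Set
  Nested i j = rotGcd i ∣ rotGcd j ⊎ rotGcd j ∣ rotGcd i

  ∣rotGcd : ∀ {d i} → d ∣ N → d ∣ toℕ i → d ∣ rotGcd i
  ∣rotGcd d∣N d∣i = gcd-greatest d∣i d∣N

  rotGcd∣ : ∀ i → rotGcd i ∣ toℕ i
  rotGcd∣ i = gcd[m,n]∣m (toℕ i) N

  rotGcd∣N : ∀ i → rotGcd i ∣ N
  rotGcd∣N i = gcd[m,n]∣n (toℕ i) N

  pow⇒rotGcd∣ : ∀ {i j} k → rot j ≡ posPow _·_ (rot i) k → rotGcd i ∣ rotGcd j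
  pow⇒rotGcd∣ {i} {j} k j=iᵏ = ∣rotGcd (rotGcd∣N i) (subst (rotGcd i ∣_) (sym j≡) gcd∣iᵏ)
    where
    j≡ : toℕ j ≡ (suc k * toℕ i) % N
    j≡ = trans (cong toℕ (rot-injective (trans j=iᵏ (rot-pow i k)))) (toℕ-mod (suc k * toℕ i))
    gcd∣iᵏ : rotGcd i ∣ (suc k * toℕ i) % N
    gcd∣iᵏ = %-presˡ-∣ (∣n⇒∣m*n (suc k) (rotGcd∣ i)) (rotGcd∣N i)

  adj⇒nested : ∀ {i j} → Adj (rot i) (rot j) → Nested i j
  adj⇒nested (_ , inj₁ (k , j=iᵏ)) = inj₁ (pow⇒rotGcd∣ k j=iᵏ)
  adj⇒nested (_ , inj₂ (k , i=jᵏ)) = inj₂ (pow⇒rotGcd∣ k i=jᵏ)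

  gcd-multiplier : ∀ x → ∃ λ c → (c * x) % N ≡ gcd x N % N
  gcd-multiplier x with Bézout.identity (gcd-GCD x N)
  ... | +- c y g+yN=cx = c , (begin
    (c * x) % N       ≡⟨ %-congˡ g+yN=cx ⟨
    (g + y * N) % N   ≡⟨ [m+kn]%n≡m%n g y N ⟩
    g % N             ∎)
    where open ≡-Reasoning; g = gcd x N
  -- here g ≡ -cx (mod N), so the multiplier (N - 1) c works
  ... | -+ c y g+cx=yN = c * m , (begin
    (c * m * x) % N                ≡⟨ [m+kn]%n≡m%n (c * m * x) y N ⟨
    (c * m * x + y * N) % N        ≡⟨ %-congˡ (cong (c * m * x +_) g+cx=yN) ⟨
    (c * m * x + (g + c * x)) % N  ≡⟨ %-congˡ (rearrange c m x g) ⟩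
    (g + c * x * N) % N            ≡⟨ [m+kn]%n≡m%n g (c * x) N ⟩
    g % N                          ∎)
    where
    open ≡-Reasoning
    g = gcd x N
    rearrange : ∀ c m x g → c * m * x + (g + c * x) ≡ g + c * x * suc m
    rearrange = solve 4 (λ c m x g → c :* m :* x :+ (g :+ c :* x) := g :+ c :* x :* (con 1 :+ m)) refl

  rotGcd∣⇒multiple : ∀ {i j : Fin N} → rotGcd i ∣ toℕ j → ∃ λ c → (c * toℕ i) % N ≡ toℕ j % N
  rotGcd∣⇒multiple {i} {j} (divides t j=tg) with gcd-multiplier (toℕ i)
  ... | c , ci≡g = t * c , (begin
    (t * c * toℕ i) % N        ≡⟨ %-congˡ (*-assoc t c (toℕ i)) ⟩
    (t * (c * toℕ i)) % N      ≡⟨ [m*[n%d]]%d≡[m*n]%d t (c * toℕ i) N ⟨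
    (t * ((c * toℕ i) % N)) % N ≡⟨ cong (λ r → (t * r) % N) ci≡g ⟩
    (t * (rotGcd i % N)) % N   ≡⟨ [m*[n%d]]%d≡[m*n]%d t (rotGcd i) N ⟩
    (t * rotGcd i) % N         ≡⟨ %-congˡ (sym j=tg) ⟩
    toℕ j % N                  ∎)
    where open ≡-Reasoning

  rotGcd∣⇒pow : ∀ {i j : Fin N} → rotGcd i ∣ toℕ j → ∃ λ k → rot j ≡ posPow _·_ (rot i) k
  rotGcd∣⇒pow {i} {j} gcd∣j with rotGcd∣⇒multiple {i} {j} gcd∣j
  -- shifting the multiplier by N makes it a successor, as posPow requires
  ... | c , ci≡j = c + m , (begin
    rot j                                 ≡⟨ cong rot (toℕ-mod-inverse j) ⟨
    rot (toℕ j mod N)                     ≡⟨ cong rot (mod-cong (toℕ j) (suc (c + m) * toℕ i) (begin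
        toℕ j % N                          ≡⟨ ci≡j ⟨
        (c * toℕ i) % N                    ≡⟨ [m+kn]%n≡m%n (c * toℕ i) (toℕ i) N ⟨
        (c * toℕ i + toℕ i * N) % N        ≡⟨ %-congˡ (rearrange c m (toℕ i)) ⟩
        (suc (c + m) * toℕ i) % N          ∎)) ⟩
    rot ((suc (c + m) * toℕ i) mod N)     ≡⟨ rot-pow i (c + m) ⟨
    posPow _·_ (rot i) (c + m)            ∎)
    where
    open ≡-Reasoning
    rearrange : ∀ c m x → c * x + x * suc m ≡ suc (c + m) * x
    rearrange = solve 3 (λ c m x → c :* x :+ x :* (con 1 :+ m) := (con 1 :+ (c :+ m)) :* x) refl

  rotGcd∣⇒adj : ∀ {i j : Fin N} → i ≢ j → rotGcd i ∣ toℕ j → Adj (rot i) (rot j)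
  rotGcd∣⇒adj i≢j gcd∣j = i≢j ∘ rot-injective , inj₁ (rotGcd∣⇒pow gcd∣j)

  nested⇒adj : ∀ {i j} → i ≢ j → Nested i j → Adj (rot i) (rot j)
  nested⇒adj {i} {j} i≢j (inj₁ gi∣gj) = rotGcd∣⇒adj i≢j (∣-trans gi∣gj (rotGcd∣ j))
  nested⇒adj {i} {j} i≢j (inj₂ gj∣gi) = adj-sym (rotGcd∣⇒adj (i≢j ∘ sym) (∣-trans gj∣gi (rotGcd∣ i)))

  module _ (Hub : Fin N → Set)
           (hub-e : Hub Fin.zero)
           (hubs-nested : ∀ {i j} → Hub i → Hub j → Nested i j)
           (paths-meet-hubs : ∀ {i j k} → i ≢ j → i ≢ k → j ≢ k → Nested i j → Nested j k →
                              Hub i ⊎ Hub j ⊎ Hub k) where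

    private
      RotHub : Dih N → Set
      RotHub (rot i) = Hub i
      RotHub (ref _) = ⊥

      rot-hubs-linked : ∀ {x y} → RotHub x → RotHub y → x ≡ y ⊎ Adj x y
      rot-hubs-linked {rot i} {rot j} Hi Hj with i Fin.≟ j
      ... | yes refl = inj₁ refl
      ... | no i≢j   = inj₂ (nested⇒adj i≢j (hubs-nested Hi Hj))

      e-hub : ∀ {x} → x ≡ e → RotHub x
      e-hub refl = hub-e

      rot-paths-meet-hubs : ∀ {x y z} → x ≢ z → Adj x y → Adj y z → RotHub x ⊎ RotHub y ⊎ RotHub z
      rot-paths-meet-hubs {y = ref _} x≢z xy yz =
        ⊥-elim (x≢z (trans (ref-adj⇒e (adj-sym xy)) (sym (ref-adj⇒e yz))))
      rot-paths-meet-hubs {ref _} {rot _} _ xy _ = inj₂ (inj₁ (e-hub (ref-adj⇒e xy)))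
      rot-paths-meet-hubs {rot _} {rot _} {ref _} _ _ yz = inj₂ (inj₁ (e-hub (ref-adj⇒e (adj-sym yz))))
      rot-paths-meet-hubs {rot i} {rot j} {rot k} x≢z xy yz =
        paths-meet-hubs (proj₁ xy ∘ cong rot) (x≢z ∘ cong rot) (proj₁ yz ∘ cong rot)
                        (adj⇒nested xy) (adj⇒nested yz)

    not-separable-by-rotation-hubs : ¬ CyclicallySeparable Adj
    not-separable-by-rotation-hubs =
      not-separable-by-hubs RotHub rot-paths-meet-hubs rot-hubs-linked

  -- for s, t ∣ N this is ⟨aˢ⟩ ∖ ⟨aᵗ⟩
  Diff : ℕ → ℕ → Dih N → Set
  Diff s t (rot i) = s ∣ toℕ i × ¬ t ∣ toℕ i
  Diff s t (ref _) = ⊥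

  diff-no-edge : ∀ {s t x y} → s ∣ N → t ∣ N → Diff s t x → Adj x y → ¬ Diff t s y
  diff-no-edge {x = rot i} {rot j} s∣N t∣N (s∣i , t∤i) xy (t∣j , s∤j) with adj⇒nested xy
  ... | inj₁ gi∣gj = s∤j (∣-trans (∣-trans (∣rotGcd s∣N s∣i) gi∣gj) (rotGcd∣ j))
  ... | inj₂ gj∣gi = t∤i (∣-trans (∣-trans (∣rotGcd t∣N t∣j) gj∣gi) (rotGcd∣ i))

  separable-by-divisors : ∀ {s t} → s ∣ N → t ∣ N →
                          Triangle (Diff s t) → Triangle (Diff t s) → CyclicallySeparable Adj
  separable-by-divisors {s} {t} s∣N t∣N =
    separable-by-triangles (Diff s t) (Diff t s) disjoint (diff-no-edge s∣N t∣N)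
    where
    disjoint : ∀ {x} → Diff s t x → ¬ Diff t s x
    disjoint {rot _} (s∣i , _) (_ , s∤i) = s∤i s∣i

  mod-adj : ∀ {u v} → u < N → v < N → u ≢ v → gcd u N ∣ v → Adj (rot (u mod N)) (rot (v mod N))
  mod-adj {u} {v} u<N v<N u≢v g∣v =
    rotGcd∣⇒adj (λ eq → u≢v (trans (sym (toℕ-mod-< u<N)) (trans (cong toℕ eq) (toℕ-mod-< v<N))))
                (subst₂ (λ x y → gcd x N ∣ y) (sym (toℕ-mod-< u<N)) (sym (toℕ-mod-< v<N)) g∣v)

  mod-diff : ∀ {s t v} → v < N → s ∣ v → ¬ t ∣ v → Diff s t (rot (v mod N))
  mod-diff {s} {t} v<N s∣v t∤v =
    subst (s ∣_) (sym (toℕ-mod-< v<N)) s∣v , t∤v ∘ subst (t ∣_) (toℕ-mod-< v<N)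

  diff-triangle : ∀ {s t r c} → N ≡ r * s → t ∣ N → ¬ t ∣ c * s → 2 ≤ c → suc c < r →
                  Triangle (Diff s t)
  diff-triangle {s} {t} {r} {c} N≡rs t∣N t∤cs 2≤c 1+c<r =
    triangle (mod-adj s<N N-s<N s≢N-s (∣-trans gcd[s,N]∣s s∣N-s))
             (mod-adj N-s<N cs<N N-s≢cs (∣-trans gcd[N-s,N]∣s (n∣m*n c)))
             (adj-sym (mod-adj s<N cs<N (<⇒≢ s<cs) (∣-trans gcd[s,N]∣s (n∣m*n c))))
             (mod-diff s<N ∣-refl t∤s ∷ mod-diff N-s<N s∣N-s t∤N-s ∷ mod-diff cs<N (n∣m*n c) t∤cs ∷ [])
    where
    instance
      s≢0 : NonZero s
      s≢0 = ≢-nonZero λ { refl → t∤cs (subst (t ∣_) (sym (*-zeroʳ c)) (t ∣0)) }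
    t∤s : ¬ t ∣ s
    t∤s = t∤cs ∘ ∣n⇒∣m*n c
    s+cs<N : s + c * s < N
    s+cs<N = subst (suc c * s <_) (sym N≡rs) (*-monoˡ-< s 1+c<r)
    s<cs : s < c * s
    s<cs = subst (s <_) (*-comm s c) (m<m*n s c 2≤c)
    s<N : s < N
    s<N = ≤-<-trans (m≤m+n s (c * s)) s+cs<N
    cs<N : c * s < N
    cs<N = ≤-<-trans (m≤n+m (c * s) s) s+cs<N
    N-s<N : N ∸ s < N
    N-s<N = ∸-monoʳ-< (n≢0⇒n>0 (≢-nonZero⁻¹ s)) (<⇒≤ s<N)
    N-s+s≡N : N ∸ s + s ≡ N
    N-s+s≡N = m∸n+n≡m (<⇒≤ s<N)
    s≢N-s : s ≢ N ∸ s
    s≢N-s s≡N-s = <⇒≢ (<-trans (+-monoʳ-< s s<cs) s+cs<N) (trans (cong (s +_) s≡N-s) (m+[n∸m]≡n (<⇒≤ s<N)))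
    N-s≢cs : N ∸ s ≢ c * s
    N-s≢cs N-s≡cs = <⇒≢ s+cs<N (trans (+-comm s (c * s)) (trans (cong (_+ s) (sym N-s≡cs)) N-s+s≡N))
    s∣N-s : s ∣ N ∸ s
    s∣N-s = ∣m∣n⇒∣m∸n (divides r N≡rs) ∣-refl (<⇒≤ s<N)
    t∤N-s : ¬ t ∣ N ∸ s
    t∤N-s t∣N-s = t∤s (∣m+n∣m⇒∣n (subst (t ∣_) (sym N-s+s≡N) t∣N) t∣N-s)
    gcd[s,N]∣s : gcd s N ∣ s
    gcd[s,N]∣s = gcd[m,n]∣m s N
    gcd[N-s,N]∣s : gcd (N ∸ s) N ∣ s
    gcd[N-s,N]∣s = ∣m+n∣m⇒∣n (subst (gcd (N ∸ s) N ∣_) (sym N-s+s≡N) (gcd[m,n]∣n (N ∸ s) N))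
                            (gcd[m,n]∣m (N ∸ s) N)

prime-power-not-separable : ∀ m {p k} → Prime p → suc m ≡ p ^ k →
                            ¬ CyclicallySeparable (PowerAdj (_·_ {suc m}))
prime-power-not-separable m {p} {k} p-prime N≡p^k =
  not-separable-by-rotation-hubs (λ _ → ⊤) tt
    (λ {i} {j} _ _ → divisors-of-prime-power-comparable {k = k} p-prime (rotGcd∣p^k i) (rotGcd∣p^k j))
    (λ _ _ _ _ _ → inj₁ tt)
  where
  open Dihedral m
  rotGcd∣p^k : ∀ i → rotGcd i ∣ p ^ k
  rotGcd∣p^k i = subst (rotGcd i ∣_) N≡p^k (rotGcd∣N i)

small-prime-product-not-separable : ∀ m {p q} → Prime p → Prime q → p ≤ 3 → suc m ≡ p * q →
                                    ¬ CyclicallySeparable (PowerAdj (_·_ {suc m}))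
small-prime-product-not-separable m {p} {q} p-prime q-prime p≤3 N≡pq =
  not-separable-by-rotation-hubs Hub (λ _ → refl) hubs-nested paths-meet-hubs
  where
  open Dihedral m

  -- hubs have gcd(i, N) ∈ {1, p, N}; the other rotations are a^q and a^(2q)
  Hub : Fin N → Set
  Hub i = q ∣ toℕ i → toℕ i ≡ 0

  hub-or-q-or-2q : ∀ i → Hub i ⊎ (toℕ i ≡ q ⊎ toℕ i ≡ 2 * q)
  hub-or-q-or-2q i with q ∣? toℕ i | toℕ i ≟ 0
  ... | no q∤i  | _       = inj₁ (⊥-elim ∘ q∤i)
  ... | yes _   | yes i≡0 = inj₁ (λ _ → i≡0)
  ... | yes q∣i | no i≢0  =
    inj₂ (nonzero-multiple<3q q∣i i≢0 (≤-trans (subst (toℕ i <_) N≡pq (toℕ<n i)) (*-monoˡ-≤ q p≤3)))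

  rotGcd-zero : ∀ {i} → toℕ i ≡ 0 → rotGcd i ≡ N
  rotGcd-zero i≡0 = trans (cong (λ v → gcd v N) i≡0) (gcd-identityˡ N)

  rotGcd∣p : ∀ {i} → ¬ q ∣ toℕ i → rotGcd i ∣ p ^ 1
  rotGcd∣p {i} q∤i = subst (rotGcd i ∣_) (sym (*-identityʳ p))
    (coprime-divisor (∤⇒coprime q-prime (q∤i ∘ flip ∣-trans (rotGcd∣ i)))
                     (subst (rotGcd i ∣_) (trans N≡pq (*-comm p q)) (rotGcd∣N i)))

  hubs-nested : ∀ {i j} → Hub i → Hub j → Nested i j
  hubs-nested {i} {j} Hi Hj with q ∣? toℕ i | q ∣? toℕ j
  ... | yes q∣i | _       = inj₂ (subst (rotGcd j ∣_) (sym (rotGcd-zero (Hi q∣i))) (rotGcd∣N j))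
  ... | no _    | yes q∣j = inj₁ (subst (rotGcd i ∣_) (sym (rotGcd-zero (Hj q∣j))) (rotGcd∣N i))
  ... | no q∤i  | no q∤j  = divisors-of-prime-power-comparable {k = 1} p-prime (rotGcd∣p q∤i) (rotGcd∣p q∤j)

  paths-meet-hubs : ∀ {i j k} → i ≢ j → i ≢ k → j ≢ k → Nested i j → Nested j k →
                    Hub i ⊎ Hub j ⊎ Hub k
  paths-meet-hubs {i} {j} {k} i≢j i≢k j≢k _ _
    with hub-or-q-or-2q i | hub-or-q-or-2q j | hub-or-q-or-2q k
  ... | inj₁ Hi | _       | _       = inj₁ Hi
  ... | inj₂ _  | inj₁ Hj | _       = inj₂ (inj₁ Hj)
  ... | inj₂ _  | inj₂ _  | inj₁ Hk = inj₂ (inj₂ Hk)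
  ... | inj₂ i∈ | inj₂ j∈ | inj₂ k∈ =
    ⊥-elim (no-three-distinct-in-pair (i≢j ∘ toℕ-injective) (i≢k ∘ toℕ-injective) (j≢k ∘ toℕ-injective) i∈ j∈ k∈)

twelve-not-separable : ¬ CyclicallySeparable (PowerAdj (_·_ {12}))
twelve-not-separable =
  not-separable-by-rotation-hubs Hub (λ { (inj₁ ()) ; (inj₂ ()) })
    (λ {i} {j} → hubs-nested {i} {j}) (λ {i} {j} {k} → paths-meet-hubs {i} {j} {k})
  where
  open Dihedral 11

  -- the hubs are the aⁱ with gcd(i, 12) in the divisibility chain 1 ∣ 2 ∣ 6 ∣ 12
  Hub : Fin 12 → Set
  Hub i = ¬ (rotGcd i ≡ 3 ⊎ rotGcd i ≡ 4)

  Hub? : ∀ i → Dec (Hub i)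
  Hub? i = ¬? (rotGcd i ≟ 3 ⊎-dec rotGcd i ≟ 4)

  Nested? : ∀ i j → Dec (Nested i j)
  Nested? i j = rotGcd i ∣? rotGcd j ⊎-dec rotGcd j ∣? rotGcd i

  hubs-nested : ∀ {i j} → Hub i → Hub j → Nested i j
  hubs-nested {i} {j} = toWitness {a? = all? λ i → all? λ j → Hub? i →-dec Hub? j →-dec Nested? i j} _ i j

  paths-meet-hubs : ∀ {i j k} → i ≢ j → i ≢ k → j ≢ k → Nested i j → Nested j k →
                    Hub i ⊎ Hub j ⊎ Hub k
  paths-meet-hubs {i} {j} {k} = toWitness {a? = all? λ i → all? λ j → all? λ k →
    ¬? (i Fin.≟ j) →-dec ¬? (i Fin.≟ k) →-dec ¬? (j Fin.≟ k) →-dec Nested? i j →-dec Nested? j k →-dec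
    (Hub? i ⊎-dec Hub? j ⊎-dec Hub? k)} _ i j k

module Separation (m : ℕ) where

  open Dihedral m

  private
    kqp≡kpq : ∀ k p q → k * q * p ≡ k * p * q
    kqp≡kpq = solve 3 (λ k p q → k :* q :* p := k :* p :* q) refl

    1qp≡pq : ∀ p q → 1 * q * p ≡ p * q
    1qp≡pq p q = trans (cong (_* p) (*-identityˡ q)) (*-comm q p)

  -- triangles aᵖ, a⁻ᵖ, a²ᵖ and a^q, a^(-q), a^(2q)
  separable-kqp : ∀ {p q k} → Prime p → Prime q → 2 < p → p < q → 3 < k * p → N ≡ k * q * p →
                  CyclicallySeparable Adj
  separable-kqp {p} {q} {k} p-prime q-prime 2<p p<q 3<kp N≡kqp =
    separable-by-divisors (divides (k * q) N≡kqp) (divides (k * p) N≡kpq)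
      (diff-triangle N≡kqp (divides (k * p) N≡kpq) (prime∤* q-prime (>⇒∤ (<-trans 2<p p<q)) (>⇒∤ p<q))
                     ≤-refl (<-≤-trans 3<kp (*-monoʳ-≤ k (<⇒≤ p<q))))
      (diff-triangle N≡kpq (divides (k * q) N≡kqp) (prime∤* p-prime (>⇒∤ 2<p) (prime∤prime p-prime q-prime (<⇒≢ p<q)))
                     ≤-refl 3<kp)
    where
    instance _ = prime⇒nonZero p-prime
    N≡kpq = trans N≡kqp (kqp≡kpq k p q)

  -- triangles a², a⁻², a⁴ and a^q, a^(-q), a^(3q)
  separable-kq2 : ∀ {q k} → Prime q → 2 < q → 2 < k → N ≡ k * q * 2 → CyclicallySeparable Adj
  separable-kq2 {q} {k} q-prime 2<q 2<k N≡kq2 =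
    separable-by-divisors (divides (k * q) N≡kq2) (divides (k * 2) N≡k2q)
      (diff-triangle N≡kq2 (divides (k * 2) N≡k2q) (prime∤* q-prime q∤2 q∤2)
                     ≤-refl (<-≤-trans (m≤m+n 4 5) (*-mono-≤ 2<k 2<q)))
      (diff-triangle N≡k2q (divides (k * q) N≡kq2) (prime∤* prime[2] 2∤3 (prime∤prime prime[2] q-prime (<⇒≢ 2<q)))
                     (m≤m+n 2 1) (<-≤-trans (m≤m+n 5 1) (*-monoˡ-≤ 2 2<k)))
    where
    N≡k2q = trans N≡kq2 (kqp≡kpq k 2 q)
    q∤2 = >⇒∤ 2<q
    2∤3 = toWitnessFalse {a? = 2 ∣? 3} _

  -- triangles a⁴, a⁻⁴, a⁸ and a^q, a^(-q), a^(2q)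
  separable-4q : ∀ {q} → Prime q → 3 < q → N ≡ 2 * q * 2 → CyclicallySeparable Adj
  separable-4q {q} q-prime 3<q N≡2q2 =
    separable-by-divisors (divides q N≡q4) (divides 4 N≡4q)
      (diff-triangle N≡q4 (divides 4 N≡4q) (prime∤* q-prime q∤2 (prime∤* q-prime q∤2 q∤2)) ≤-refl 3<q)
      (diff-triangle N≡4q (divides q N≡q4) (2∤q ∘ *-cancelˡ-∣ 2) ≤-refl ≤-refl)
    where
    N≡4q = trans N≡2q2 (kqp≡kpq 2 2 q)
    N≡q4 = trans N≡4q (*-comm 4 q)
    2<q = <-trans (m≤m+n 3 0) 3<q
    q∤2 = >⇒∤ 2<q
    2∤q = prime∤prime prime[2] q-prime (<⇒≢ 2<q)

  separable-kq2-cases : ∀ {q} k → Prime q → 2 < q → N ≡ k * q * 2 →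
                        ¬ SmallPrimeProduct N → N ≢ 12 → CyclicallySeparable Adj
  separable-kq2-cases zero _ _ () _ _
  separable-kq2-cases {q} 1 q-prime 2<q N≡1q2 ¬small _ =
    ⊥-elim (¬small (2 , q , prime[2] , q-prime , 2<q , m≤m+n 2 1 , trans N≡1q2 (1qp≡pq 2 q)))
  separable-kq2-cases {q} 2 q-prime 2<q N≡2q2 _ N≢12 with q ≟ 3
  ... | yes refl = ⊥-elim (N≢12 N≡2q2)
  ... | no q≢3   = separable-4q {q} q-prime (≤∧≢⇒< 2<q (q≢3 ∘ sym)) N≡2q2
  separable-kq2-cases {q} k@(suc (suc (suc _))) q-prime 2<q N≡kq2 _ _ =
    separable-kq2 {q} {k} q-prime 2<q (s≤s (s≤s (s≤s z≤n))) N≡kq2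

  separable-kqp-cases : ∀ {p q} k → Prime p → Prime q → 2 < p → p < q → N ≡ k * q * p →
                        ¬ SmallPrimeProduct N → CyclicallySeparable Adj
  separable-kqp-cases zero _ _ _ _ () _
  separable-kqp-cases {p} {q} 1 p-prime q-prime 2<p p<q N≡1qp ¬small with p ≟ 3
  ... | yes refl = ⊥-elim (¬small (3 , q , p-prime , q-prime , p<q , ≤-refl , trans N≡1qp (1qp≡pq 3 q)))
  ... | no p≢3   = separable-kqp {p} {q} {1} p-prime q-prime 2<p p<q
                     (subst (3 <_) (sym (*-identityˡ p)) (≤∧≢⇒< 2<p (p≢3 ∘ sym))) N≡1qp
  separable-kqp-cases {p} {q} k@(suc (suc _)) p-prime q-prime 2<p p<q N≡kqp _ =
    separable-kqp {p} {q} {k} p-prime q-prime 2<p p<q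
      (<-≤-trans (m≤m+n 4 2) (*-mono-≤ {2} {k} (s≤s (s≤s z≤n)) 2<p)) N≡kqp

  separable-of-cofactor : ∀ {p q} → Prime p → Prime q → p < q → (∃ λ k → N ≡ k * q * p) →
                          ¬ SmallPrimeProduct N → N ≢ 12 → CyclicallySeparable Adj
  separable-of-cofactor {p} p-prime q-prime p<q (k , N≡kqp) ¬small N≢12 with p ≟ 2
  ... | yes refl = separable-kq2-cases k q-prime p<q N≡kqp ¬small N≢12
  ... | no p≢2   = separable-kqp-cases k p-prime q-prime (≤∧≢⇒< (prime>1 p-prime) (p≢2 ∘ sym))
                     p<q N≡kqp ¬small

  separable-of-two-primes : TwoPrimeDivisors N → ¬ SmallPrimeProduct N → N ≢ 12 →
                            CyclicallySeparable Adj
  separable-of-two-primes (p , q , p-prime , q-prime , p≢q , p∣N , q∣N) ¬small N≢12 with <-cmp p q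
  ... | tri< p<q _ _ =
    separable-of-cofactor p-prime q-prime p<q (cofactor p-prime q-prime p≢q p∣N q∣N) ¬small N≢12
  ... | tri≈ _ p≡q _ = ⊥-elim (p≢q p≡q)
  ... | tri> _ _ q<p =
    separable-of-cofactor q-prime p-prime q<p (cofactor q-prime p-prime (p≢q ∘ sym) q∣N p∣N) ¬small N≢12

mainTheorem6 : (n : ℕ) → 3 ≤ n →
    CyclicallySeparable (PowerAdj (_·_ {n}))
    ⇔ ((Σ ℕ λ p → Σ ℕ λ q → Prime p × Prime q × p ≢ q × p ∣ n × q ∣ n)
       × ¬ (Σ ℕ λ p₁ → Σ ℕ λ p₂ → Prime p₁ × Prime p₂ × p₁ < p₂ × p₁ ≤ 3 × n ≡ p₁ * p₂)
       × n ≢ 12)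
mainTheorem6 n@(suc m) (s≤s 2≤m) = mk⇔
  (λ separable → two-prime-divisors separable
               , (λ { (_ , _ , p-prime , q-prime , _ , p≤3 , n≡pq) →
                      small-prime-product-not-separable m p-prime q-prime p≤3 n≡pq separable })
               , (λ { refl → twelve-not-separable separable }))
  (λ (two-primes , ¬small , n≢12) → Separation.separable-of-two-primes m two-primes ¬small n≢12)
  where
  two-prime-divisors : CyclicallySeparable (PowerAdj (_·_ {n})) → TwoPrimeDivisors n
  two-prime-divisors separable with prime-power-or-two-prime-divisors n (≤-trans 2≤m (n≤1+n m))
  ... | inj₁ (_ , k , p-prime , n≡pᵏ) = ⊥-elim (prime-power-not-separable m {k = k} p-prime n≡pᵏ separable)
  ... | inj₂ two-primes               = two-primes
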